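{- Let $\mathbf V$ be a unital quantale, let $(\mathbf A,F)$ be a $\mathbf V$-F-semilattice and let $j$ be a $\mathbf V$-F-prenucleus on $(\mathbf A,F)$. Then $A_j=\{a\in A\mid j(a)=a\}$ (with the order inherited from $A$) is a closure system in $(A,\le)$, whose associated closure operator is $\mathrm n(j)(a)=\bigwedge\{x\in A_j\mid a\le x\}$. Moreover, $\mathrm n(j)$ is a $\mathbf V$-F-nucleus on $(\mathbf A,F)$.
   Context: A unital quantale $\mathbf V=(V,\bigvee,\otimes,e)$: complete lattice, monoid, $\otimes$ distributing over arbitrary joins on both sides. A $\mathbf V$-module $(A,\bigvee,*)$: complete lattice with $*\colon V\times A\to A$ preserving joins in each argument, $u*(v*a)=(u\otimes v)*a$, $e*a=a$. A $\mathbf V$-F-semilattice is $(\mathbf A,F)$ with $F$ a module endomorphism. A $\mathbf V$-F-prenucleus on $(\mathbf A,F)$ is $j\colon A\to A$ with $a\le j(a)$, $a\le b\Rightarrow j(a)\le j(b)$, $v*j(a)\le j(v*a)$ for $v\in V$, and $F(j(a))\le j(F(a))$; a $\mathbf V$-F-nucleus is additionally idempotent. A closure system is a subset closed under arbitrary meets. -}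

module Defs where

open import Level using (Level; suc; _⊔_)
open import Data.Product using (Σ; _×_; _,_)
open import Relation.Binary.PropositionalEquality using (_≡_)
open import Relation.Binary.Structures using (IsPartialOrder)

record CompleteLattice (ℓ : Level) : Set (suc ℓ) where
  infix 4 _≤_
  field
    Carrier        : Set ℓ
    _≤_            : Carrier → Carrier → Set ℓ
    isPartialOrder : IsPartialOrder _≡_ _≤_
    ⋁              : (Carrier → Set ℓ) → Carrier
    ⋁-upper        : (S : Carrier → Set ℓ) (s : Carrier) → S s → s ≤ ⋁ S
    ⋁-least        : (S : Carrier → Set ℓ) (b : Carrier) →
                     ((s : Carrier) → S s → s ≤ b) → ⋁ S ≤ b
    ⋀              : (Carrier → Set ℓ) → Carrier
    ⋀-lower        : (S : Carrier → Set ℓ) (s : Carrier) → S s → ⋀ S ≤ s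
    ⋀-greatest     : (S : Carrier → Set ℓ) (b : Carrier) →
                     ((s : Carrier) → S s → b ≤ s) → b ≤ ⋀ S

Image : ∀ {ℓ} {X Y : Set ℓ} → (X → Y) → (X → Set ℓ) → (Y → Set ℓ)
Image {X = X} f S y = Σ X (λ x → S x × (y ≡ f x))

record Quantale (ℓ : Level) : Set (suc ℓ) where
  field
    lattice : CompleteLattice ℓ
  open CompleteLattice lattice public
  infixl 7 _⊗_
  field
    _⊗_       : Carrier → Carrier → Carrier
    e         : Carrier
    ⊗-assoc   : (u v w : Carrier) → (u ⊗ v) ⊗ w ≡ u ⊗ (v ⊗ w)
    ⊗-identityˡ : (u : Carrier) → e ⊗ u ≡ u
    ⊗-identityʳ : (u : Carrier) → u ⊗ e ≡ u
    ⊗-distribˡ-⋁ : (u : Carrier) (S : Carrier → Set ℓ) →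
                   u ⊗ ⋁ S ≡ ⋁ (Image (u ⊗_) S)
    ⊗-distribʳ-⋁ : (S : Carrier → Set ℓ) (u : Carrier) →
                   ⋁ S ⊗ u ≡ ⋁ (Image (_⊗ u) S)

record Module {ℓ : Level} (V : Quantale ℓ) : Set (suc ℓ) where
  private module V = Quantale V
  field
    lattice : CompleteLattice ℓ
  open CompleteLattice lattice public
  infixr 7 _*_
  field
    _*_      : V.Carrier → Carrier → Carrier
    *-⋁ʳ     : (v : V.Carrier) (S : Carrier → Set ℓ) →
               v * ⋁ S ≡ ⋁ (Image (v *_) S)
    *-⋁ˡ     : (T : V.Carrier → Set ℓ) (a : Carrier) →
               V.⋁ T * a ≡ ⋁ (Image (_* a) T)
    *-assoc  : (u v : V.Carrier) (a : Carrier) → u * (v * a) ≡ (u V.⊗ v) * a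
    *-identity : (a : Carrier) → V.e * a ≡ a

record FSemilattice {ℓ : Level} (V : Quantale ℓ) : Set (suc ℓ) where
  field
    module' : Module V
  open Module module' public
  field
    F       : Carrier → Carrier
    F-⋁     : (S : Carrier → Set ℓ) → F (⋁ S) ≡ ⋁ (Image F S)
    F-*     : (v : Quantale.Carrier V) (a : Carrier) → F (v * a) ≡ v * F a

module _ {ℓ : Level} {V : Quantale ℓ} (AF : FSemilattice V) where
  open FSemilattice AF

  record IsFPrenucleus (j : Carrier → Carrier) : Set ℓ where
    field
      extensive : (a : Carrier) → a ≤ j a
      monotone  : (a b : Carrier) → a ≤ b → j a ≤ j b
      *-lax     : (v : Quantale.Carrier V) (a : Carrier) → v * j a ≤ j (v * a)
      F-lax     : (a : Carrier) → F (j a) ≤ j (F a)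

  record IsFNucleus (j : Carrier → Carrier) : Set ℓ where
    field
      isFPrenucleus : IsFPrenucleus j
      idempotent    : (a : Carrier) → j (j a) ≡ j a

  Fix : (Carrier → Carrier) → Carrier → Set ℓ
  Fix j a = j a ≡ a

  IsClosureSystem : (Carrier → Set ℓ) → Set (suc ℓ)
  IsClosureSystem C = (S : Carrier → Set ℓ) → ((x : Carrier) → S x → C x) → C (⋀ S)

  closureOf : (Carrier → Set ℓ) → Carrier → Carrier
  closureOf C a = ⋀ (λ x → C x × (a ≤ x))

  n : (Carrier → Carrier) → Carrier → Carrier
  n j = closureOf (Fix j)

-- The fixed points of an extensive monotone j are closed under meets, since
-- j (⋀ S) ≤ j s = s for every s ∈ S.  A join-preserving map h has an upper adjoint
-- h⁎ x = ⋁ { b | h b ≤ x }, and h ∘ j ≤ j ∘ h makes h⁎ preserve fixed points of j.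
-- Hence for a ≤ h⁎ x with x fixed, the least fixed point n(j) a above a lies below
-- h⁎ x, i.e. h (n(j) a) ≤ x; taking h = v * _ and h = F gives the two lax laws.
module Submission where

open import Defs
open import Level using (Level)
open import Data.Product using (_×_; _,_; proj₁; proj₂)
open import Function.Bundles using (_⇔_; mk⇔; Equivalence)
open import Relation.Binary.PropositionalEquality using (_≡_; refl; sym; cong; subst)
open import Relation.Binary.Structures using (IsPartialOrder)

module _ {ℓ : Level} {V : Quantale ℓ} (AF : FSemilattice V) where
  open FSemilattice AF
  open IsPartialOrder isPartialOrder using (antisym)
    renaming (refl to ≤-refl; trans to ≤-trans)

  Fix-isClosureSystem : (j : Carrier → Carrier) →
    (∀ a → a ≤ j a) → (∀ {a b} → a ≤ b → j a ≤ j b) →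
    IsClosureSystem AF (Fix AF j)
  Fix-isClosureSystem j extensive monotone S S⊆Fix = antisym
    (⋀-greatest S (j (⋀ S)) λ s s∈S →
      subst (j (⋀ S) ≤_) (S⊆Fix s s∈S) (monotone (⋀-lower S s s∈S)))
    (extensive (⋀ S))

  module _ (C : Carrier → Set ℓ) where

    closureOf-extensive : ∀ a → a ≤ closureOf AF C a
    closureOf-extensive a = ⋀-greatest _ a λ _ → proj₂

    closureOf-least : ∀ {a x} → C x → a ≤ x → closureOf AF C a ≤ x
    closureOf-least {x = x} x∈C a≤x = ⋀-lower _ x (x∈C , a≤x)

    closureOf-monotone : ∀ {a b} → a ≤ b → closureOf AF C a ≤ closureOf AF C b
    closureOf-monotone {a} a≤b = ⋀-greatest _ (closureOf AF C a) λ x (x∈C , b≤x) →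
      closureOf-least x∈C (≤-trans a≤b b≤x)

    module _ (closed : IsClosureSystem AF C) where

      closureOf-∈ : ∀ a → C (closureOf AF C a)
      closureOf-∈ a = closed _ λ _ → proj₁

      closureOf-fixed⇔∈ : ∀ a → Fix AF (closureOf AF C) a ⇔ C a
      closureOf-fixed⇔∈ a = mk⇔
        (λ cl-a≡a → subst C cl-a≡a (closureOf-∈ a))
        (λ a∈C → antisym (closureOf-least a∈C ≤-refl) (closureOf-extensive a))

      closureOf-idempotent : ∀ a → closureOf AF C (closureOf AF C a) ≡ closureOf AF C a
      closureOf-idempotent a =
        Equivalence.from (closureOf-fixed⇔∈ (closureOf AF C a)) (closureOf-∈ a)

  module _ (h : Carrier → Carrier) (h-⋁ : ∀ S → h (⋁ S) ≡ ⋁ (Image h S)) where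

    ⋁-preserving⇒monotone : ∀ {a b} → a ≤ b → h a ≤ h b
    ⋁-preserving⇒monotone {a} {b} a≤b =
      subst (h a ≤_) (cong h ⋁↓b≡b)
        (subst (h a ≤_) (sym (h-⋁ ↓b)) (⋁-upper _ (h a) (a , a≤b , refl)))
      where
        ↓b : Carrier → Set ℓ
        ↓b y = y ≤ b
        ⋁↓b≡b : ⋁ ↓b ≡ b
        ⋁↓b≡b = antisym (⋁-least ↓b b λ _ y≤b → y≤b) (⋁-upper ↓b b ≤-refl)

    upperAdjoint : Carrier → Carrier
    upperAdjoint x = ⋁ (λ b → h b ≤ x)

    upperAdjoint-unit : ∀ {a x} → h a ≤ x → a ≤ upperAdjoint x
    upperAdjoint-unit {a} = ⋁-upper _ a

    upperAdjoint-counit : ∀ x → h (upperAdjoint x) ≤ x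
    upperAdjoint-counit x = subst (_≤ x) (sym (h-⋁ _))
      (⋁-least _ x λ { _ (_ , hb≤x , refl) → hb≤x })

    upperAdjoint-preserves-Fix : (j : Carrier → Carrier) →
      (∀ a → a ≤ j a) → (∀ {a b} → a ≤ b → j a ≤ j b) → (∀ a → h (j a) ≤ j (h a)) →
      ∀ {x} → Fix AF j x → Fix AF j (upperAdjoint x)
    upperAdjoint-preserves-Fix j extensive monotone h-lax {x} jx≡x = antisym
      (upperAdjoint-unit (≤-trans (h-lax (upperAdjoint x))
        (subst (j (h (upperAdjoint x)) ≤_) jx≡x (monotone (upperAdjoint-counit x)))))
      (extensive (upperAdjoint x))

    closureOf-lax : (C : Carrier → Set ℓ) → (∀ {x} → C x → C (upperAdjoint x)) →
      ∀ a → h (closureOf AF C a) ≤ closureOf AF C (h a)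
    closureOf-lax C upperAdjoint-∈ a = ⋀-greatest _ _ λ x (x∈C , ha≤x) →
      ≤-trans (⋁-preserving⇒monotone
                 (closureOf-least C (upperAdjoint-∈ x∈C) (upperAdjoint-unit ha≤x)))
              (upperAdjoint-counit x)

  module _ (j : Carrier → Carrier) (pre : IsFPrenucleus AF j) where
    open IsFPrenucleus pre

    private
      j-monotone : ∀ {a b} → a ≤ b → j a ≤ j b
      j-monotone = monotone _ _

      n-lax : (h : Carrier → Carrier) (h-⋁ : ∀ S → h (⋁ S) ≡ ⋁ (Image h S)) →
        (∀ a → h (j a) ≤ j (h a)) → ∀ a → h (n AF j a) ≤ n AF j (h a)
      n-lax h h-⋁ h-lax = closureOf-lax h h-⋁ (Fix AF j)
        (upperAdjoint-preserves-Fix h h-⋁ j extensive j-monotone h-lax)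

    n-isFNucleus : IsFNucleus AF (n AF j)
    n-isFNucleus = record
      { isFPrenucleus = record
        { extensive = closureOf-extensive (Fix AF j)
        ; monotone  = λ _ _ → closureOf-monotone (Fix AF j)
        ; *-lax     = λ v → n-lax (v *_) (*-⋁ʳ v) (*-lax v)
        ; F-lax     = n-lax F F-⋁ F-lax
        }
      ; idempotent = closureOf-idempotent (Fix AF j) (Fix-isClosureSystem j extensive j-monotone)
      }

mainTheorem12 : {ℓ : Level} {V : Quantale ℓ} (AF : FSemilattice V)
    (j : FSemilattice.Carrier AF → FSemilattice.Carrier AF) →
    IsFPrenucleus AF j →
    IsClosureSystem AF (Fix AF j)
    × ((a : FSemilattice.Carrier AF) → Fix AF (n AF j) a ⇔ Fix AF j a)
    × IsFNucleus AF (n AF j)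
mainTheorem12 AF j pre =
  Fix-j-closed , closureOf-fixed⇔∈ AF (Fix AF j) Fix-j-closed , n-isFNucleus AF j pre
  where
    open IsFPrenucleus pre
    Fix-j-closed : IsClosureSystem AF (Fix AF j)
    Fix-j-closed = Fix-isClosureSystem AF j extensive (monotone _ _)
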